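{- Let $H=(V,E_H,z)$ be a hypergraph with nonnegative hyperedge weights and let $G$ be either the associated graph of $H$ or a simple associated graph of $H$, with the map $\phi:E(G)\to E_H$ sending each edge of $G$ to the hyperedge it came from. Let $\alpha>1$ and let $G'$ be an $\alpha$-spanner of $G$. Then the sub-hypergraph $H'$ of $H$ with vertex set $V$ and hyperedge set $\{\phi(e')\mid e'\in E(G')\}$ is an $\alpha$-hyperspanner of $H$, i.e. $\delta_{H'}(u,v)\le \alpha\,\delta_H(u,v)$ for all $u,v\in V$.
   Context: The associated graph of $H$ is the weighted multigraph on $V$ obtained by replacing each hyperedge $h$ with a clique on the vertices of $h$ whose edges all have weight $z(h)$ (so parallel edges may arise from different hyperedges). A simple associated graph of $H$ is obtained from the associated graph by keeping, for every pair of vertices, only one lightest edge among the parallel edges between them (ties broken arbitrarily). A subgraph $G'$ of a weighted graph $G$ on the same vertex set is an $\alpha$-spanner if $\delta_{G'}(u,v)\le\alpha\,\delta_G(u,v)$ for all vertices $u,v$. Distances in a hypergraph: a $u$–$v$ path is a sequence $u=x_0,\dots,x_\ell=v$ with hyperedges $h_1,\dots,h_\ell$, $x_{j-1},x_j\in h_j$, of length $\sum_j z(h_j)$; $\delta_H(u,v)$ is the minimum such length.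
   Formalization: The hyperedge weights z and the parameter α take rational values. -}

module Defs where

open import Data.Nat using (ℕ)
open import Data.Fin using (Fin) renaming (_<_ to _<ᶠ_)
open import Data.Fin.Subset using (Subset; _∈_)
open import Data.Product using (Σ; Σ-syntax; _×_; _,_; ∃)
open import Data.Sum using (_⊎_)
open import Data.Rational using (ℚ; 0ℚ; _+_; _*_; _≤_; _<_)
open import Relation.Binary.PropositionalEquality using (_≡_)

-- A hypergraph on vertex set V = Fin n with m hyperedges (indexed by Fin m,
-- so distinct indices may carry the same vertex set) and nonnegative weights z.
record Hypergraph (n : ℕ) : Set where
  field
    m      : ℕ
    verts  : Fin m → Subset n
    z      : Fin m → ℚ
    nonneg : ∀ h → 0ℚ ≤ z h
open Hypergraph public

-- Walks in H using only hyperedges satisfying `allowed` (a sub-hypergraph on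
-- the same vertex set). step h : x, y ∈ h, then continue from y.
data HWalk {n} (H : Hypergraph n) (allowed : Fin (m H) → Set)
     : Fin n → Fin n → Set where
  []   : ∀ {u} → HWalk H allowed u u
  step : ∀ {x y v} (h : Fin (m H)) → allowed h →
         x ∈ verts H h → y ∈ verts H h →
         HWalk H allowed y v → HWalk H allowed x v

hlen : ∀ {n} {H : Hypergraph n} {A u v} → HWalk H A u v → ℚ
hlen []                         = 0ℚ
hlen {H = H} (step h _ _ _ p)   = z H h + hlen p

allH : ∀ {n} (H : Hypergraph n) → Fin (m H) → Set
allH H _ = Data.Unit.⊤ where import Data.Unit

-- H' (hyperedge set given by predicate A) is an α-hyperspanner of H:
-- δ_{H'}(u,v) ≤ α δ_H(u,v) for all u v, phrased over walks:
-- every H-walk from u to v is matched by an H'-walk at most α times as long.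
IsHyperspanner : ∀ {n} (H : Hypergraph n) → (Fin (m H) → Set) → ℚ → Set
IsHyperspanner {n} H A α =
  ∀ (u v : Fin n) (p : HWalk H (allH H) u v) →
    Σ (HWalk H A u v) λ p' → hlen p' ≤ α * hlen p

record Graph (n : ℕ) : Set₁ where
  field
    E   : Set
    src : E → Fin n
    tgt : E → Fin n
    w   : E → ℚ
open Graph public

data GWalk {n} (G : Graph n) (allowed : E G → Set) : Fin n → Fin n → Set where
  []   : ∀ {u} → GWalk G allowed u u
  step : ∀ {x y v} (e : E G) → allowed e →
         ((src G e ≡ x × tgt G e ≡ y) ⊎ (src G e ≡ y × tgt G e ≡ x)) →
         GWalk G allowed y v → GWalk G allowed x v

glen : ∀ {n} {G : Graph n} {A u v} → GWalk G A u v → ℚ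
glen []                        = 0ℚ
glen {G = G} (step e _ _ p)    = w G e + glen p

allG : ∀ {n} (G : Graph n) → E G → Set
allG G _ = Data.Unit.⊤ where import Data.Unit

IsSpanner : ∀ {n} (G : Graph n) → (E G → Set) → ℚ → Set
IsSpanner {n} G A α =
  ∀ (u v : Fin n) (p : GWalk G (allG G) u v) →
    Σ (GWalk G A u v) λ p' → glen p' ≤ α * glen p

AssocEdge : ∀ {n} → Hypergraph n → Set
AssocEdge {n} H = Σ (Fin (m H)) λ h → Σ (Fin n) λ x → Σ (Fin n) λ y →
  (x <ᶠ y) × (x ∈ verts H h) × (y ∈ verts H h)

assocGraph : ∀ {n} → Hypergraph n → Graph n
assocGraph H = record
  { E = AssocEdge H
  ; src = λ { (h , x , y , _) → x }
  ; tgt = λ { (h , x , y , _) → y }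
  ; w   = λ { (h , _) → z H h } }

assocφ : ∀ {n} (H : Hypergraph n) → AssocEdge H → Fin (m H)
assocφ H (h , _) = h

-- A choice of lightest hyperedge for every pair x < y covered by some
-- hyperedge (ties broken arbitrarily by `pick`; its value on uncovered
-- pairs is irrelevant).
record LightestChoice {n} (H : Hypergraph n) : Set where
  field
    pick : Fin n → Fin n → Fin (m H)
    spec : ∀ x y → x <ᶠ y → ∀ h → x ∈ verts H h → y ∈ verts H h →
           (x ∈ verts H (pick x y)) × (y ∈ verts H (pick x y)) ×
           (z H (pick x y) ≤ z H h)
open LightestChoice public

SimpleEdge : ∀ {n} (H : Hypergraph n) → LightestChoice H → Set
SimpleEdge {n} H c = Σ (Fin n) λ x → Σ (Fin n) λ y →
  (x <ᶠ y) × (x ∈ verts H (pick c x y)) × (y ∈ verts H (pick c x y))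

simpleGraph : ∀ {n} (H : Hypergraph n) → LightestChoice H → Graph n
simpleGraph H c = record
  { E = SimpleEdge H c
  ; src = λ { (x , y , _) → x }
  ; tgt = λ { (x , y , _) → y }
  ; w   = λ { (x , y , _) → z H (pick c x y) } }

simpleφ : ∀ {n} (H : Hypergraph n) (c : LightestChoice H) →
          SimpleEdge H c → Fin (m H)
simpleφ H c (x , y , _) = pick c x y

data AssocKind {n} (H : Hypergraph n) : Set where
  full   : AssocKind H
  simple : LightestChoice H → AssocKind H

graphOf : ∀ {n} (H : Hypergraph n) → AssocKind H → Graph n
graphOf H full       = assocGraph H
graphOf H (simple c) = simpleGraph H c

φOf : ∀ {n} (H : Hypergraph n) (k : AssocKind H) → E (graphOf H k) → Fin (m H)
φOf H full       = assocφ H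
φOf H (simple c) = simpleφ H c

imageOf : ∀ {n} (H : Hypergraph n) (k : AssocKind H) →
          (E (graphOf H k) → Set) → Fin (m H) → Set
imageOf H k A h = Σ (E (graphOf H k)) λ e → A e × φOf H k e ≡ h

-- A walk in H becomes a walk in G that is no longer: a hop inside a
-- hyperedge h between distinct vertices is replaced by the edge of h's clique
-- (or by a lighter parallel edge), and a hop with equal ends is dropped, which
-- is harmless as weights are nonnegative. The spanner G' shortens that walk up
-- to a factor α, and every edge e' of G' is again a hop inside φ(e'), a
-- hyperedge of H' no heavier than e'.
module Submission where

open import Defs
open import Data.Nat using (ℕ)
open import Data.Rational using (ℚ; 0ℚ; 1ℚ; _+_; _*_; _≤_; _<_; nonNegative)
open import Data.Rational.Properties
  using (≤-refl; ≤-trans; <⇒≤; <-trans; +-identityˡ; +-mono-≤; +-monoˡ-≤; +-monoʳ-≤;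
         *-monoˡ-≤-nonNeg; positive⁻¹; module ≤-Reasoning)
open import Data.Fin using (Fin) renaming (_<_ to _<ᶠ_)
open import Data.Fin.Properties using (<-cmp)
open import Data.Fin.Subset using (_∈_)
open import Data.Product using (Σ; _×_; _,_)
open import Data.Sum using (_⊎_; inj₁; inj₂)
open import Data.Unit using (tt)
open import Relation.Binary.Definitions using (tri<; tri≈; tri>)
open import Relation.Binary.PropositionalEquality using (_≡_; refl; subst)

p≤q+p : ∀ {q} p → 0ℚ ≤ q → p ≤ q + p
p≤q+p {q} p 0≤q = subst (_≤ q + p) (+-identityˡ p) (+-monoˡ-≤ p 0≤q)

record IsAssociatedGraph {n} (H : Hypergraph n) (G : Graph n) (φ : E G → Fin (m H)) : Set where
  field
    edge-between : ∀ h {x y} → x <ᶠ y → x ∈ verts H h → y ∈ verts H h →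
                   Σ (E G) λ e → src G e ≡ x × tgt G e ≡ y × w G e ≤ z H h
    src∈φ        : ∀ e → src G e ∈ verts H (φ e)
    tgt∈φ        : ∀ e → tgt G e ∈ verts H (φ e)
    z∘φ≤w        : ∀ e → z H (φ e) ≤ w G e

module _ {n} {H : Hypergraph n} {G : Graph n} {φ : E G → Fin (m H)}
         (assoc : IsAssociatedGraph H G φ) where
  open IsAssociatedGraph assoc

  image : (E G → Set) → Fin (m H) → Set
  image A h = Σ (E G) λ e → A e × φ e ≡ h

  hop⇒gwalk : ∀ h {x y v} → x ∈ verts H h → y ∈ verts H h →
              (q : GWalk G (allG G) y v) →
              Σ (GWalk G (allG G) x v) λ q' → glen q' ≤ z H h + glen q
  hop⇒gwalk h {x} {y} x∈h y∈h q with <-cmp x y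
  ... | tri< x<y _ _ = let e , src≡x , tgt≡y , w≤z = edge-between h x<y x∈h y∈h
                       in step e tt (inj₁ (src≡x , tgt≡y)) q , +-monoˡ-≤ (glen q) w≤z
  ... | tri≈ _ refl _ = q , p≤q+p (glen q) (nonneg H h)
  ... | tri> _ _ y<x = let e , src≡y , tgt≡x , w≤z = edge-between h y<x y∈h x∈h
                       in step e tt (inj₂ (src≡y , tgt≡x)) q , +-monoˡ-≤ (glen q) w≤z

  hwalk⇒gwalk : ∀ {B u v} (p : HWalk H B u v) →
                Σ (GWalk G (allG G) u v) λ q → glen q ≤ hlen p
  hwalk⇒gwalk []                       = [] , ≤-refl
  hwalk⇒gwalk (step h _ x∈h y∈h p) =
    let q , q≤p = hwalk⇒gwalk p
        q' , q'≤hq = hop⇒gwalk h x∈h y∈h q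
    in q' , ≤-trans q'≤hq (+-monoʳ-≤ (z H h) q≤p)

  ends∈φ : ∀ e {x y} → (src G e ≡ x × tgt G e ≡ y) ⊎ (src G e ≡ y × tgt G e ≡ x) →
           x ∈ verts H (φ e) × y ∈ verts H (φ e)
  ends∈φ e (inj₁ (refl , refl)) = src∈φ e , tgt∈φ e
  ends∈φ e (inj₂ (refl , refl)) = tgt∈φ e , src∈φ e

  gwalk⇒hwalk : ∀ {A u v} (q : GWalk G A u v) →
                Σ (HWalk H (image A) u v) λ p → hlen p ≤ glen q
  gwalk⇒hwalk []               = [] , ≤-refl
  gwalk⇒hwalk (step e a ends q) =
    let p , p≤q = gwalk⇒hwalk q
        x∈φe , y∈φe = ends∈φ e ends
    in step (φ e) (e , a , refl) x∈φe y∈φe p , +-mono-≤ (z∘φ≤w e) p≤q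

  spanner⇒hyperspanner : ∀ {α} → 0ℚ ≤ α → (A : E G → Set) → IsSpanner G A α →
                         IsHyperspanner H (image A) α
  spanner⇒hyperspanner {α} 0≤α A spanner u v p =
    let q , q≤p = hwalk⇒gwalk p
        q' , q'≤αq = spanner u v q
        p' , p'≤q' = gwalk⇒hwalk q'
    in p' , (begin
      hlen p'    ≤⟨ p'≤q' ⟩
      glen q'    ≤⟨ q'≤αq ⟩
      α * glen q ≤⟨ *-monoˡ-≤-nonNeg α {{nonNegative 0≤α}} q≤p ⟩
      α * hlen p ∎)
    where open ≤-Reasoning

assocGraph-isAssociated : ∀ {n} (H : Hypergraph n) →
                          IsAssociatedGraph H (assocGraph H) (assocφ H)
assocGraph-isAssociated H = record
  { edge-between = λ h {x} {y} x<y x∈h y∈h →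
      (h , x , y , x<y , x∈h , y∈h) , refl , refl , ≤-refl
  ; src∈φ        = λ { (_ , _ , _ , _ , x∈h , _) → x∈h }
  ; tgt∈φ        = λ { (_ , _ , _ , _ , _ , y∈h) → y∈h }
  ; z∘φ≤w        = λ _ → ≤-refl
  }

simpleGraph-isAssociated : ∀ {n} (H : Hypergraph n) (c : LightestChoice H) →
                           IsAssociatedGraph H (simpleGraph H c) (simpleφ H c)
simpleGraph-isAssociated H c = record
  { edge-between = λ h {x} {y} x<y x∈h y∈h →
      let x∈pick , y∈pick , pick≤h = spec c x y x<y h x∈h y∈h
      in (x , y , x<y , x∈pick , y∈pick) , refl , refl , pick≤h
  ; src∈φ        = λ { (_ , _ , _ , x∈pick , _) → x∈pick }
  ; tgt∈φ        = λ { (_ , _ , _ , _ , y∈pick) → y∈pick }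
  ; z∘φ≤w        = λ _ → ≤-refl
  }

graphOf-isAssociated : ∀ {n} (H : Hypergraph n) (k : AssocKind H) →
                       IsAssociatedGraph H (graphOf H k) (φOf H k)
graphOf-isAssociated H full       = assocGraph-isAssociated H
graphOf-isAssociated H (simple c) = simpleGraph-isAssociated H c

lemma1 : ∀ {n : ℕ} (H : Hypergraph n) (k : AssocKind H) (α : ℚ) → 1ℚ < α →
         (A : E (graphOf H k) → Set) → IsSpanner (graphOf H k) A α →
         IsHyperspanner H (imageOf H k A) α
lemma1 H k α 1<α = spanner⇒hyperspanner (graphOf-isAssociated H k) 0≤α
  where
  0≤α : 0ℚ ≤ α
  0≤α = <⇒≤ (<-trans (positive⁻¹ 1ℚ) 1<α)
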